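{- Let $\lambda=(\lambda_1,\dots,\lambda_r)$ be a partition with $r\ge 2$, and let $\bar\lambda$ be the result of an \textsc{RIT}-move on an even-numbered row of $\lambda$. Then there exists an \textsc{RIT}-move on an odd-numbered row of $\bar\lambda$, resulting in a partition $\tilde\lambda$, such that $\mathrm{rem}(\tilde\lambda)=\mathrm{rem}(\lambda)$.
   Context: An \textsc{RIT} (Row Impartial Terminus) position is a partition $\lambda=(\lambda_1,\dots,\lambda_r)$, written as a nonincreasing tuple of nonnegative integers (a move keeps the length $r$ of the tuple, zero entries being allowed). For $k\in[1,\lambda_1]$, there is a move from $\lambda$ to $\bar\lambda$ where $\bar\lambda_i=k-1$ for $i$ the largest index with $\lambda_i\ge k$, and $\bar\lambda_j=\lambda_j$ for $j\ne i$; this is called a move on the $i$th row. Informally, a move shortens one row of the Young diagram so that the result is still a Young diagram. Define $\mathrm{rem}(\lambda)$ to be the $\lceil r/2\rceil$-tuple $(\lambda_1-\lambda_2,\lambda_3-\lambda_4,\dots,\lambda_{2\lceil r/2\rceil-1}-\lambda_{2\lceil r/2\rceil})$, where $\lambda_j=0$ for $j>r$. -}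

module Defs where

open import Data.Nat using (ℕ; zero; suc; _∸_; _<_; _≤_)
open import Data.Fin using (Fin; toℕ) renaming (_<_ to _<ᶠ_; _≤_ to _≤ᶠ_)
open import Data.Vec using (Vec; lookup; _[_]≔_; toList)
open import Data.List using (List; []; _∷_)
open import Data.Product using (Σ; _×_)
open import Relation.Binary.PropositionalEquality using (_≡_)

-- A partition of length r: a nonincreasing tuple of natural numbers
-- (zero entries allowed).  Fin index i stands for row (toℕ i + 1).
IsPartition : ∀ {r} → Vec ℕ r → Set
IsPartition {r} λ′ = (i j : Fin r) → i ≤ᶠ j → lookup λ′ j ≤ lookup λ′ i

RITMoveWith : ∀ {r} → Vec ℕ r → Fin r → ℕ → Vec ℕ r → Set
RITMoveWith {r} λ′ i k μ =
  (1 ≤ k) × (k ≤ lookup λ′ i) × ((j : Fin r) → i <ᶠ j → lookup λ′ j < k)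
  × (μ ≡ λ′ [ i ]≔ (k ∸ 1))

RITMove : ∀ {r} → Vec ℕ r → Fin r → Vec ℕ r → Set
RITMove λ′ i μ = Σ ℕ (λ k → RITMoveWith λ′ i k μ)

remL : List ℕ → List ℕ
remL [] = []
remL (a ∷ []) = a ∷ []
remL (a ∷ b ∷ t) = (a ∸ b) ∷ remL t

rem : ∀ {r} → Vec ℕ r → List ℕ
rem λ′ = remL (toList λ′)

{-# OPTIONS --safe #-}
-- If the move shortens the even row 2m to k, shorten row 2m-1 to
-- k + (λ₂ₘ₋₁ - λ₂ₘ). This is a legal move, since every row below 2m-1 now has
-- length at most k, and it restores the difference λ₂ₘ₋₁ - λ₂ₘ, which is the
-- only entry of rem that the two moves touch.
module Submission where

open import Defs
open import Data.Nat using (ℕ; zero; suc; _+_; _∸_; _≤_; _<_; s≤s; z≤n)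
open import Data.Nat.Properties
  using (m≤m+n; m+n∸m≡n; m+[n∸m]≡n; +-monoˡ-<; +-comm; ≤-refl; <⇒≤; <-≤-trans; 1+n≢n; m≤n⇒m<n∨m≡n)
open import Data.Nat.Divisibility using (_∣_; ∣1⇒≡1; ∣m+n∣m⇒∣n; ∣-refl)
open import Data.Fin using (Fin; toℕ; inject₁) renaming (zero to fzero; suc to fsuc; _<_ to _<ᶠ_)
open import Data.Fin.Properties using (toℕ-inject₁; toℕ-injective; ≤̄⇒inject₁<; <⇒≢)
open import Data.Vec using (Vec; _∷_; lookup; _[_]≔_)
open import Data.Vec.Properties using (lookup∘update; lookup∘update′)
import Data.List as List
open import Data.Product using (Σ; _×_; _,_)
open import Data.Sum using (inj₁; inj₂)
open import Data.Empty using (⊥-elim)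
open import Relation.Nullary using (¬_)
open import Relation.Binary.PropositionalEquality using (_≡_; _≢_; refl; sym; trans; cong; subst; ≢-sym)

2∤1 : ¬ 2 ∣ 1
2∤1 2∣1 with ∣1⇒≡1 2∣1
... | ()

2∣n⇒2∤1+n : ∀ {n} → 2 ∣ n → ¬ 2 ∣ suc n
2∣n⇒2∤1+n {n} 2∣n 2∣1+n = 2∤1 (∣m+n∣m⇒∣n (subst (2 ∣_) (+-comm 1 n) 2∣1+n) 2∣n)

k<l≤m⇒k+[m∸l]<m : ∀ {k l m} → k < l → l ≤ m → k + (m ∸ l) < m
k<l≤m⇒k+[m∸l]<m {k} {l} {m} k<l l≤m =
  subst (k + (m ∸ l) <_) (m+[n∸m]≡n l≤m) (+-monoˡ-< (m ∸ l) k<l)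

rem-[]≔-pair : ∀ {n} (v : Vec ℕ (suc n)) (i : Fin n) → 2 ∣ toℕ i → ∀ {a b} →
  a ∸ b ≡ lookup v (inject₁ i) ∸ lookup v (fsuc i) →
  rem ((v [ fsuc i ]≔ b) [ inject₁ i ]≔ a) ≡ rem v
rem-[]≔-pair (x ∷ y ∷ w) fzero _ eq = cong (List._∷ rem w) eq
rem-[]≔-pair (x ∷ y ∷ w) (fsuc fzero) 2∣1 _ = ⊥-elim (2∤1 2∣1)
rem-[]≔-pair (x ∷ y ∷ w) (fsuc (fsuc i)) 2∣2+i eq =
  cong ((x ∸ y) List.∷_) (rem-[]≔-pair w i (∣m+n∣m⇒∣n 2∣2+i ∣-refl) eq)

gap-restoring-move : ∀ {n} {λ′ : Vec ℕ (suc n)} {i : Fin n} {k} → IsPartition λ′ →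
  let λ̄ = λ′ [ fsuc i ]≔ k
      t = k + (lookup λ′ (inject₁ i) ∸ lookup λ′ (fsuc i))
  in RITMoveWith λ′ (fsuc i) (suc k) λ̄ → RITMoveWith λ̄ (inject₁ i) (suc t) (λ̄ [ inject₁ i ]≔ t)
gap-restoring-move {λ′ = λ′} {i} {k} λ′-partition (_ , k<λᵢ₊₁ , below-suc-k , refl) =
  s≤s z≤n , t<λ̄ᵢ , below-suc-t , refl
  where
  λ̄ = λ′ [ fsuc i ]≔ k
  t = k + (lookup λ′ (inject₁ i) ∸ lookup λ′ (fsuc i))

  k<1+t : k < suc t
  k<1+t = s≤s (m≤m+n k _)

  t<λ̄ᵢ : t < lookup λ̄ (inject₁ i)
  t<λ̄ᵢ = subst (t <_) (sym (lookup∘update′ i≢1+i λ′ k))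
    (k<l≤m⇒k+[m∸l]<m k<λᵢ₊₁ (λ′-partition (inject₁ i) (fsuc i) (<⇒≤ (≤̄⇒inject₁< ≤-refl))))
    where
    i≢1+i : inject₁ i ≢ fsuc i
    i≢1+i eq = 1+n≢n (trans (cong toℕ (sym eq)) (toℕ-inject₁ i))

  below-suc-t : ∀ j → inject₁ i <ᶠ j → lookup λ̄ j < suc t
  below-suc-t j i<j with m≤n⇒m<n∨m≡n (subst (_< toℕ j) (toℕ-inject₁ i) i<j)
  ... | inj₁ 1+i<j = subst (_< suc t) (sym (lookup∘update′ (≢-sym (<⇒≢ 1+i<j)) λ′ k))
                       (<-≤-trans (below-suc-k j 1+i<j) k<1+t)
  ... | inj₂ 1+i≡j with refl ← toℕ-injective 1+i≡j =
                       subst (_< suc t) (sym (lookup∘update (fsuc i) λ′ k)) k<1+t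

lemma3p2 : (r : ℕ) → 2 ≤ r → (λ′ : Vec ℕ r) → IsPartition λ′ →
    (i : Fin r) → 2 ∣ suc (toℕ i) → (λ̄ : Vec ℕ r) → RITMove λ′ i λ̄ →
    Σ (Fin r) (λ j → Σ (Vec ℕ r) (λ λ̃ →
      (¬ (2 ∣ suc (toℕ j))) × RITMove λ̄ j λ̃ × (rem λ̃ ≡ rem λ′)))
lemma3p2 _ _ _ _ fzero 2∣1 _ _ = ⊥-elim (2∤1 2∣1)
lemma3p2 _ _ _ _ (fsuc _) _ _ (zero , () , _)
lemma3p2 _ _ λ′ λ′-partition (fsuc i) 2∣2+i _ (suc k , move@(_ , _ , _ , refl)) =
  inject₁ i , _ , row-i-odd , (_ , gap-restoring-move λ′-partition move) ,
  rem-[]≔-pair λ′ i 2∣i (m+n∸m≡n k _)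
  where
  2∣i : 2 ∣ toℕ i
  2∣i = ∣m+n∣m⇒∣n 2∣2+i ∣-refl

  row-i-odd : ¬ 2 ∣ suc (toℕ (inject₁ i))
  row-i-odd = subst (λ m → ¬ 2 ∣ suc m) (sym (toℕ-inject₁ i)) (2∣n⇒2∤1+n 2∣i)
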